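{- Let $\mathcal{P}$ be a hereditary property of tournaments and let $M \in \mathbb{N}$. If $B(\mathcal{P}) = M+1$, then $|\mathcal{P}_n| = O(n^M)$.
   Context: Tournaments are unlabelled; a hereditary property of tournaments is a class closed under isomorphism and induced sub-tournaments; $\mathcal{P}_n$ is the set of its members on $n$ vertices. In a tournament $T$, for vertices $u,v$ write $u \curvearrowright v$ if $u \to v$ and there exist $k \geq 0$ and vertices $w_1,\ldots,w_k$ such that, with $C = \{u,w_1,\ldots,w_k,v\}$: (i) $u \to w_i \to v$ for all $i$; (ii) $w_i \to w_j$ for $i<j$; (iii) every $x \notin C$ has the same orientation ($x \to y$ for all $y \in C$, or $y \to x$ for all $y \in C$) to all vertices of $C$. Write $u \sim v$ if $u=v$, $u \curvearrowright v$ or $v \curvearrowright u$; this is an equivalence relation whose classes are the homogeneous blocks of $T$. $B(T)$ is the number of homogeneous blocks of $T$, and $B(\mathcal{P}) = \sup\{B(T) : T \in \mathcal{P}\}$. -}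

module Defs where

open import Data.Nat using (ℕ; _≤_; _<_; _≥_; _*_; _^_; suc)
open import Data.Fin using (Fin) renaming (_<_ to _<ᶠ_)
open import Data.Bool using (Bool; true; false)
open import Data.Product using (Σ; ∃; _×_; _,_)
open import Data.Sum using (_⊎_)
open import Data.List using (List; length)
open import Data.List.Relation.Unary.All using (All)
open import Data.List.Relation.Unary.AllPairs using (AllPairs)
open import Relation.Binary.PropositionalEquality using (_≡_; _≢_)
open import Relation.Nullary using (¬_)
open import Function.Bundles using (_↔_; Inverse)
open import Function.Definitions using (Injective; Surjective)
open import Level using (0ℓ) renaming (suc to lsuc)

record Tournament (n : ℕ) : Set where
  field
    adj        : Fin n → Fin n → Bool
    irreflexive : ∀ u → adj u u ≡ false
    tournament  : ∀ u v → u ≢ v → adj u v ≢ adj v u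

open Tournament public

_⊢_⟶_ : ∀ {n} → Tournament n → Fin n → Fin n → Set
T ⊢ u ⟶ v = adj T u v ≡ true

Iso : ∀ {n} → Tournament n → Tournament n → Set
Iso {n} T T' = Σ (Fin n ↔ Fin n) λ f →
  ∀ u v → adj T' (Inverse.to f u) (Inverse.to f v) ≡ adj T u v

induced : ∀ {m n} → Tournament n → (g : Fin m → Fin n) → Injective _≡_ _≡_ g → Tournament m
induced T g inj = record
  { adj = λ i j → adj T (g i) (g j)
  ; irreflexive = λ i → irreflexive T (g i)
  ; tournament = λ i j i≢j → tournament T (g i) (g j) (λ e → i≢j (inj e))
  }

Property : Set₁
Property = ∀ {n} → Tournament n → Set

Hereditary : Property → Set
Hereditary P =
  (∀ {n} (T T' : Tournament n) → Iso T T' → P T → P T') ×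
  (∀ {m n} (T : Tournament n) (g : Fin m → Fin n) (inj : Injective _≡_ _≡_ g) →
     P T → P (induced T g inj))

-- u ↷ v in T, witnessed by k and w₁,…,w_k (as w : Fin k → Fin n).
_⊢_↷_ : ∀ {n} → Tournament n → Fin n → Fin n → Set
_⊢_↷_ {n} T u v =
  T ⊢ u ⟶ v ×
  Σ ℕ λ k → Σ (Fin k → Fin n) λ w →
    let InC : Fin n → Set
        InC y = y ≡ u ⊎ y ≡ v ⊎ ∃ λ i → y ≡ w i
    in (∀ i → T ⊢ u ⟶ w i × T ⊢ w i ⟶ v) ×
       (∀ i j → i <ᶠ j → T ⊢ w i ⟶ w j) ×
       (∀ x → ¬ InC x →
          (∀ y → InC y → T ⊢ x ⟶ y) ⊎ (∀ y → InC y → T ⊢ y ⟶ x))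

_⊢_∼_ : ∀ {n} → Tournament n → Fin n → Fin n → Set
T ⊢ u ∼ v = u ≡ v ⊎ T ⊢ u ↷ v ⊎ T ⊢ v ↷ u

-- T has exactly b homogeneous blocks: a surjective labelling of the vertices
-- by Fin b whose fibres are exactly the ∼-classes.
HasBlocks : ∀ {n} → Tournament n → ℕ → Set
HasBlocks {n} T b = Σ (Fin n → Fin b) λ cls →
  Surjective _≡_ _≡_ cls ×
  (∀ u v → (T ⊢ u ∼ v → cls u ≡ cls v) × (cls u ≡ cls v → T ⊢ u ∼ v))

-- B(𝒫) = b : every member has at most b blocks, and some member has exactly b.
SupBlocks≡ : Property → ℕ → Set
SupBlocks≡ P b =
  (∀ {n} (T : Tournament n) → P T → ∀ c → HasBlocks T c → c ≤ b) ×
  (Σ ℕ λ n → Σ (Tournament n) λ T → P T × HasBlocks T b)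

-- |𝒫_n| ≤ K : every family of pairwise non-isomorphic members of 𝒫 on n
-- vertices has at most K elements (i.e. at most K isomorphism classes).
CountAtMost : Property → ℕ → ℕ → Set
CountAtMost P n K = (ts : List (Tournament n)) → All P ts →
  AllPairs (λ T T' → ¬ Iso T T') ts → length ts ≤ K

CountBigO : Property → ℕ → Set
CountBigO P M = Σ ℕ λ C → Σ ℕ λ N → ∀ n → n ≥ N → CountAtMost P n (C * n ^ M)

-- The homogeneous blocks partition the vertices: ↷-witnesses are chains, which can be
-- cut into segments and spliced, and this makes ∼ transitive. Every vertex outside a
-- block sees the whole block in the same direction, and in-degree strictly increases
-- along the arcs inside a block. Ranking the vertices by (block, in-degree) therefore
-- identifies a tournament with at most M + 1 blocks with a canonical tournament on
-- {0, …, n - 1}, determined by M cut points in {0, …, n} delimiting the blocks and by a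
-- tournament on the M + 1 blocks. Pairwise non-isomorphic members of 𝒫_n receive
-- distinct such descriptions, so |𝒫_n| ≤ 2^((M+1)²) · (n + 1)^M ≤ 2^((M+1)² + M) · n^M.

module Submission where

open import Defs
open import Data.Bool using (Bool; true; false; not)
import Data.Bool.Properties as Bool
open import Data.Fin as Fin
  using (Fin; toℕ; fromℕ<; inject≤; punchOut; combine; funToFin; finToFun)
  renaming (zero to fzero; suc to fsuc)
open import Data.Fin.Properties as Fin
  using (_≤?_; _<?_; any?; toℕ<n; toℕ-fromℕ<; fromℕ<-toℕ; toℕ-injective; inject≤-injective;
         injective⇒≤; punchOut-injective; suc-injective; combine-injective; finToFun-funToFin;
         2↔Bool)
  renaming (_≟_ to _≟ᶠ_)
open import Data.List using (List; length; lookup)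
open import Data.List.Membership.Propositional.Properties using (∈-lookup)
import Data.List.Relation.Unary.All as All
open import Data.List.Relation.Unary.AllPairs using (AllPairs; _∷_)
open import Data.Nat as ℕ
  using (ℕ; zero; suc; _+_; _∸_; _*_; _^_; _≤_; _<_; z≤n; s≤s; s≤s⁻¹; z<s; s<s; s<s⁻¹)
open import Data.Nat.Properties as ℕ
  using (≤-antisym; ≤-reflexive; <-irrefl; <-trans; <-cmp; <⇒≤; ≮⇒≥; ≤⇒≯; ≤-<-trans;
         <-≤-trans; m≤n⇒m≤1+n; m<n⇒m<1+n; n<1+n; m<1+n⇒m<n∨m≡n; m≤m+n; m+n≮m; +-suc;
         +-identityʳ; +-monoʳ-<; +-cancelˡ-<; m+[n∸m]≡n; m+n∸m≡n; m≤n⇒∃[o]m+o≡n; anyUpTo?;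
         <-strictTotalOrder)
open import Data.Product using (Σ; ∃; _×_; _,_; proj₁; proj₂)
open import Data.Product.Relation.Binary.Lex.Strict using (×-strictTotalOrder)
open import Data.Sum using (_⊎_; inj₁; inj₂)
open import Function.Base using (_∘_; case_of_)
open import Function.Bundles using (_↔_; Inverse; mk↔ₛ′)
open import Function.Definitions using (Injective; Surjective)
open import Function.Properties.Inverse using (↔-trans; ↔-sym)
open import Level using (Level; 0ℓ)
open import Relation.Binary.Bundles using (StrictTotalOrder)
import Relation.Binary.Construct.On as On
open import Relation.Binary.Core using (Rel)
open import Relation.Binary.Definitions using (Decidable; Transitive; tri<; tri≈; tri>)
open import Relation.Binary.PropositionalEquality
open import Relation.Binary.Structures using (IsEquivalence)
open import Relation.Nullary using (¬_; Dec; yes; no; does; contradiction; _×-dec_)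
open import Relation.Nullary.Decidable
  using (dec-true; dec-false; decidable-stable; ¬¬-excluded-middle)
open import Relation.Nullary.Negation using (¬¬-map)
open import Relation.Unary as U using (Pred; _⊆_)

open import Algebra.Properties.CommutativeSemigroup ℕ.*-commutativeSemigroup using (interchange)

private
  variable
    ℓ : Level
    m n : ℕ

count : {P : Pred (Fin n) ℓ} → U.Decidable P → ℕ
count {n = zero}  P? = 0
count {n = suc n} P? with P? fzero
... | yes _ = suc (count (P? ∘ fsuc))
... | no  _ = count (P? ∘ fsuc)

count-mono : {P Q : Pred (Fin n) ℓ} (P? : U.Decidable P) (Q? : U.Decidable Q) →
             P ⊆ Q → count P? ≤ count Q?
count-mono {n = zero}  P? Q? P⊆Q = z≤n
count-mono {n = suc n} P? Q? P⊆Q with P? fzero | Q? fzero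
... | yes _ | yes _  = s≤s (count-mono (P? ∘ fsuc) (Q? ∘ fsuc) P⊆Q)
... | yes p | no  ¬q = contradiction (P⊆Q p) ¬q
... | no  _ | yes _  = m≤n⇒m≤1+n (count-mono (P? ∘ fsuc) (Q? ∘ fsuc) P⊆Q)
... | no  _ | no  _  = count-mono (P? ∘ fsuc) (Q? ∘ fsuc) P⊆Q

count-strict : {P Q : Pred (Fin n) ℓ} (P? : U.Decidable P) (Q? : U.Decidable Q) →
               P ⊆ Q → ∀ i → ¬ P i → Q i → count P? < count Q?
count-strict {n = suc n} P? Q? P⊆Q i ¬pi qi with P? fzero | Q? fzero | i
... | yes p | no  ¬q | _      = contradiction (P⊆Q p) ¬q
... | no  _ | no  ¬q | fzero  = contradiction qi ¬q
... | yes p | yes _  | fzero  = contradiction p ¬pi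
... | no  _ | yes _  | fzero  = s≤s (count-mono (P? ∘ fsuc) (Q? ∘ fsuc) P⊆Q)
... | yes _ | yes _  | fsuc i = s≤s (count-strict (P? ∘ fsuc) (Q? ∘ fsuc) P⊆Q i ¬pi qi)
... | no  _ | yes _  | fsuc i = m<n⇒m<1+n (count-strict (P? ∘ fsuc) (Q? ∘ fsuc) P⊆Q i ¬pi qi)
... | no  _ | no  _  | fsuc i = count-strict (P? ∘ fsuc) (Q? ∘ fsuc) P⊆Q i ¬pi qi

count-cong : {P Q : Pred (Fin n) ℓ} (P? : U.Decidable P) (Q? : U.Decidable Q) →
             P ⊆ Q → Q ⊆ P → count P? ≡ count Q?
count-cong P? Q? P⊆Q Q⊆P = ≤-antisym (count-mono P? Q? P⊆Q) (count-mono Q? P? Q⊆P)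

count≤n : {P : Pred (Fin n) ℓ} (P? : U.Decidable P) → count P? ≤ n
count≤n {n = zero}  P? = z≤n
count≤n {n = suc n} P? with P? fzero
... | yes _ = s≤s (count≤n (P? ∘ fsuc))
... | no  _ = m≤n⇒m≤1+n (count≤n (P? ∘ fsuc))

count<n : {P : Pred (Fin n) ℓ} (P? : U.Decidable P) → ∀ i → ¬ P i → count P? < n
count<n {n = suc n} P? i ¬pi with P? fzero | i
... | yes p | fzero  = contradiction p ¬pi
... | no  _ | fzero  = s≤s (count≤n (P? ∘ fsuc))
... | yes _ | fsuc i = s≤s (count<n (P? ∘ fsuc) i ¬pi)
... | no  _ | fsuc i = m<n⇒m<1+n (count<n (P? ∘ fsuc) i ¬pi)

count-< : ∀ (i : Fin (suc n)) → count (λ (j : Fin n) → j <? i) ≡ toℕ i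
count-< {n = zero}  fzero    = refl
count-< {n = suc n} fzero with fzero {n} <? fzero {suc n}
... | no _ = trans (count-cong (λ (j : Fin n) → fsuc j <? fzero {n}) (λ j → j <? fzero {n})
                               (λ ()) (λ ()))
                   (count-< {n} fzero)
count-< {n = suc n} (fsuc i) with fzero {n} <? fsuc i
... | yes _ = cong suc (trans (count-cong (λ (j : Fin n) → fsuc j <? fsuc i) (λ j → j <? i)
                                          s<s⁻¹ s<s)
                              (count-< i))
... | no  0≮ = contradiction z<s 0≮

¬¬-Π : {A : Fin n → Set ℓ} → (∀ i → ¬ ¬ A i) → ¬ ¬ (∀ i → A i)
¬¬-Π {n = zero}  ¬¬A ¬∀ = ¬∀ (λ ())
¬¬-Π {n = suc n} ¬¬A ¬∀ = ¬¬A fzero λ a₀ → ¬¬-Π (¬¬A ∘ fsuc) λ as →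
  ¬∀ λ { fzero → a₀ ; (fsuc i) → as i }

¬¬-decidable : {R : Fin m → Fin n → Set ℓ} → ¬ ¬ (∀ i j → Dec (R i j))
¬¬-decidable = ¬¬-Π λ i → ¬¬-Π λ j → ¬¬-excluded-middle

injective⇒surjective : {f : Fin n → Fin n} → Injective _≡_ _≡_ f → ∀ y → ∃ λ x → f x ≡ y
injective⇒surjective {n = suc n} {f} f-inj y with any? (λ x → f x ≟ᶠ y)
... | yes hit = hit
... | no miss = contradiction (injective⇒≤ g-inj) (<-irrefl refl)
  where
  y≢f : ∀ x → y ≢ f x
  y≢f x y≡fx = miss (x , sym y≡fx)
  g : Fin (suc n) → Fin n
  g x = punchOut (y≢f x)
  g-inj : Injective _≡_ _≡_ g
  g-inj gx≡gx′ = f-inj (punchOut-injective (y≢f _) (y≢f _) gx≡gx′)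

injective⇒↔ : (f : Fin n → Fin n) → Injective _≡_ _≡_ f → Fin n ↔ Fin n
injective⇒↔ f f-inj =
  mk↔ₛ′ f (proj₁ ∘ surj) (proj₂ ∘ surj) (λ x → f-inj (proj₂ (surj (f x))))
  where surj = injective⇒surjective f-inj

module Rank {_≺_ : Rel (Fin n) ℓ} (_≺?_ : Decidable _≺_) (≺-irrefl : ∀ {u} → ¬ u ≺ u)
            (≺-trans : Transitive _≺_) (≺-connex : ∀ {u v} → u ≢ v → u ≺ v ⊎ v ≺ u) where

  rank : Fin n → Fin n
  rank u = fromℕ< (count<n (_≺? u) u ≺-irrefl)

  toℕ-rank : ∀ u → toℕ (rank u) ≡ count (_≺? u)
  toℕ-rank u = toℕ-fromℕ< _

  rank-mono : ∀ {u v} → u ≺ v → rank u Fin.< rank v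
  rank-mono {u} {v} u≺v = subst₂ _<_ (sym (toℕ-rank u)) (sym (toℕ-rank v))
    (count-strict (_≺? u) (_≺? v) (λ w≺u → ≺-trans w≺u u≺v) u ≺-irrefl u≺v)

  rank-injective : Injective _≡_ _≡_ rank
  rank-injective {u} {v} ru≡rv with u ≟ᶠ v
  ... | yes u≡v = u≡v
  ... | no  u≢v with ≺-connex u≢v
  ...   | inj₁ u≺v = contradiction (rank-mono u≺v) (Fin.<-irrefl ru≡rv)
  ...   | inj₂ v≺u = contradiction (rank-mono v≺u) (Fin.<-irrefl (sym ru≡rv))

  rank↔ : Fin n ↔ Fin n
  rank↔ = injective⇒↔ rank rank-injective

record Quotient (R : Rel (Fin n) ℓ) : Set ℓ where
  field
    size             : ℕ
    class            : Fin n → Fin size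
    class-surjective : ∀ c → ∃ λ u → class u ≡ c
    R⇒≡              : ∀ {u v} → R u v → class u ≡ class v
    ≡⇒R              : ∀ {u v} → class u ≡ class v → R u v

quotient : {R : Rel (Fin n) ℓ} → Decidable R → IsEquivalence R → Quotient R
quotient {n = zero} R? eq = record
  { size = 0 ; class = λ () ; class-surjective = λ () ; R⇒≡ = λ {} ; ≡⇒R = λ {} }
quotient {n = suc n} {R = R} R? eq with any? (λ v → R? fzero (fsuc v))
... | yes (v , R0v) = record
  { size = size ; class = class′ ; class-surjective = surj′ ; R⇒≡ = R⇒≡′ ; ≡⇒R = ≡⇒R′ }
  where
  module E = IsEquivalence eq
  open Quotient (quotient (On.decidable fsuc R R?) (On.isEquivalence fsuc eq))
  class′ : Fin (suc n) → Fin size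
  class′ fzero    = class v
  class′ (fsuc u) = class u
  surj′ : ∀ c → ∃ λ u → class′ u ≡ c
  surj′ c with u , e ← class-surjective c = fsuc u , e
  R⇒≡′ : ∀ {u w} → R u w → class′ u ≡ class′ w
  R⇒≡′ {fzero}  {fzero}  _ = refl
  R⇒≡′ {fzero}  {fsuc w} r = R⇒≡ (E.trans (E.sym R0v) r)
  R⇒≡′ {fsuc u} {fzero}  r = R⇒≡ (E.trans r R0v)
  R⇒≡′ {fsuc u} {fsuc w} r = R⇒≡ r
  ≡⇒R′ : ∀ {u w} → class′ u ≡ class′ w → R u w
  ≡⇒R′ {fzero}  {fzero}  _ = E.refl
  ≡⇒R′ {fzero}  {fsuc w} e = E.trans R0v (≡⇒R e)
  ≡⇒R′ {fsuc u} {fzero}  e = E.trans (≡⇒R e) (E.sym R0v)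
  ≡⇒R′ {fsuc u} {fsuc w} e = ≡⇒R e
... | no ¬R0 = record
  { size = suc size ; class = class′ ; class-surjective = surj′ ; R⇒≡ = R⇒≡′ ; ≡⇒R = ≡⇒R′ }
  where
  module E = IsEquivalence eq
  open Quotient (quotient (On.decidable fsuc R R?) (On.isEquivalence fsuc eq))
  class′ : Fin (suc n) → Fin (suc size)
  class′ fzero    = fzero
  class′ (fsuc u) = fsuc (class u)
  surj′ : ∀ c → ∃ λ u → class′ u ≡ c
  surj′ fzero    = fzero , refl
  surj′ (fsuc c) with u , e ← class-surjective c = fsuc u , cong fsuc e
  R⇒≡′ : ∀ {u w} → R u w → class′ u ≡ class′ w
  R⇒≡′ {fzero}  {fzero}  _ = refl
  R⇒≡′ {fzero}  {fsuc w} r = contradiction (w , r) ¬R0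
  R⇒≡′ {fsuc u} {fzero}  r = contradiction (u , E.sym r) ¬R0
  R⇒≡′ {fsuc u} {fsuc w} r = cong fsuc (R⇒≡ r)
  ≡⇒R′ : ∀ {u w} → class′ u ≡ class′ w → R u w
  ≡⇒R′ {fzero}  {fzero}  _ = E.refl
  ≡⇒R′ {fsuc u} {fsuc w} e = ≡⇒R (suc-injective e)

<-+-view : ∀ {i s m} → i < s + m → i < s ⊎ ∃ λ j → j < m × i ≡ s + j
<-+-view {i} {s} {m} i<s+m with i ℕ.<? s
... | yes i<s = inj₁ i<s
... | no  i≮s = inj₂ (i ∸ s , +-cancelˡ-< s (i ∸ s) m (subst (_< s + m) i≡ i<s+m) , i≡)
  where i≡ = sym (m+[n∸m]≡n (≮⇒≥ i≮s))

<2+-view : ∀ {i k} → i < suc (suc k) →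
           i ≡ 0 ⊎ i ≡ suc k ⊎ ∃ λ (l : Fin k) → i ≡ suc (toℕ l)
<2+-view {zero}  _ = inj₁ refl
<2+-view {suc i} {k} i<2+k with m<1+n⇒m<n∨m≡n (s<s⁻¹ i<2+k)
... | inj₁ i<k  = inj₂ (inj₂ (fromℕ< i<k , cong suc (sym (toℕ-fromℕ< i<k))))
... | inj₂ refl = inj₂ (inj₁ refl)

^-distribʳ-* : ∀ m n k → (m * n) ^ k ≡ m ^ k * n ^ k
^-distribʳ-* m n zero    = refl
^-distribʳ-* m n (suc k) =
  trans (cong (m * n *_) (^-distribʳ-* m n k)) (interchange m n (m ^ k) (n ^ k))

AllPairs-lookup : ∀ {a} {A : Set a} {R : Rel A ℓ} {xs : List A} → AllPairs R xs →
                  ∀ {i j} → i Fin.< j → R (lookup xs i) (lookup xs j)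
AllPairs-lookup (Rx ∷ _)  {fzero}  {fsuc j} _   = All.lookup Rx (∈-lookup j)
AllPairs-lookup (_ ∷ Rxs) {fsuc i} {fsuc j} i<j = AllPairs-lookup Rxs (s<s⁻¹ i<j)

module HomogeneousBlocks (T : Tournament n) where

  infix 4 _⟶_ _↷_ _∼_

  _⟶_ _↷_ _∼_ : Fin n → Fin n → Set
  u ⟶ v = T ⊢ u ⟶ v
  u ↷ v = T ⊢ u ↷ v
  u ∼ v = T ⊢ u ∼ v

  ⟶-irrefl : ∀ {u} → ¬ u ⟶ u
  ⟶-irrefl {u} u⟶u with () ← trans (sym u⟶u) (irreflexive T u)

  adj-flip : ∀ {u v} → u ≢ v → adj T u v ≡ not (adj T v u)
  adj-flip u≢v = Bool.¬-not (tournament T _ _ u≢v)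

  ⟶-asym : ∀ {u v} → u ⟶ v → ¬ v ⟶ u
  ⟶-asym {u} {v} u⟶v v⟶u with u ≟ᶠ v
  ... | yes refl = ⟶-irrefl u⟶v
  ... | no  u≢v  = tournament T u v u≢v (trans u⟶v (sym v⟶u))

  ⟶-connex : ∀ {u v} → u ≢ v → u ⟶ v ⊎ v ⟶ u
  ⟶-connex {u} {v} u≢v with adj T u v in uv
  ... | true  = inj₁ refl
  ... | false = inj₂ (trans (adj-flip (u≢v ∘ sym)) (cong not uv))

  ¬⟶⇒adj≡false : ∀ {u v} → ¬ u ⟶ v → adj T u v ≡ false
  ¬⟶⇒adj≡false = Bool.¬-not

  InChain : ℕ → (ℕ → Fin n) → Pred (Fin n) 0ℓ
  InChain m c y = ∃ λ i → i < m × y ≡ c i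

  inChain? : ∀ m c → U.Decidable (InChain m c)
  inChain? m c y = anyUpTo? (λ i → y ≟ᶠ c i) m

  Uniform : ℕ → (ℕ → Fin n) → Pred (Fin n) 0ℓ
  Uniform m c y = (∀ {i} → i < m → y ⟶ c i) ⊎ (∀ {i} → i < m → c i ⟶ y)

  -- Only c 0, …, c (m - 1) matter; indexing by ℕ lets segments and splicings of chains
  -- be formed without casts between Fin types.
  record Chain (m : ℕ) (c : ℕ → Fin n) : Set where
    field
      ascending : ∀ {i j} → i < j → j < m → c i ⟶ c j
      uniform   : ∀ y → ¬ InChain m c y → Uniform m c y

  open Chain

  Chain-index-< : ∀ {m c i j} → Chain m c → i < m → j < m → c i ⟶ c j → i < j
  Chain-index-< {i = i} {j} ch i<m j<m cᵢ⟶cⱼ with <-cmp i j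
  ... | tri< i<j _ _  = i<j
  ... | tri≈ _ refl _ = contradiction cᵢ⟶cⱼ ⟶-irrefl
  ... | tri> _ _ j<i  = contradiction (ascending ch j<i i<m) (⟶-asym cᵢ⟶cⱼ)

  Chain-take : ∀ {m m′ c} → Chain m c → m′ ≤ m → Chain m′ c
  Chain-take {m} {m′} {c} ch m′≤m = record
    { ascending = λ i<j j<m′ → ascending ch i<j (<-≤-trans j<m′ m′≤m)
    ; uniform   = uniform′
    }
    where
    uniform′ : ∀ y → ¬ InChain m′ c y → Uniform m′ c y
    uniform′ y y∉ with inChain? m c y
    ... | yes (p , p<m , refl) = inj₂ λ i<m′ → ascending ch (<-≤-trans i<m′ m′≤p) p<m
      where m′≤p = ≮⇒≥ λ p<m′ → y∉ (p , p<m′ , refl)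
    ... | no  y∉c with uniform ch y y∉c
    ...   | inj₁ y⟶c = inj₁ λ i<m′ → y⟶c (<-≤-trans i<m′ m′≤m)
    ...   | inj₂ c⟶y = inj₂ λ i<m′ → c⟶y (<-≤-trans i<m′ m′≤m)

  Chain-drop : ∀ i {m c} → Chain (i + m) c → Chain m (λ j → c (i + j))
  Chain-drop i {m} {c} ch = record
    { ascending = λ j<k k<m → ascending ch (+-monoʳ-< i j<k) (+-monoʳ-< i k<m)
    ; uniform   = uniform′
    }
    where
    uniform′ : ∀ y → ¬ InChain m (λ j → c (i + j)) y → Uniform m (λ j → c (i + j)) y
    uniform′ y y∉ with inChain? (i + m) c y
    ... | yes (p , p<i+m , refl) with <-+-view {s = i} p<i+m
    ...   | inj₁ p<i =
      inj₁ λ {j} j<m → ascending ch (<-≤-trans p<i (m≤m+n i j)) (+-monoʳ-< i j<m)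
    ...   | inj₂ (j , j<m , refl) = contradiction (j , j<m , refl) y∉
    uniform′ y y∉ | no y∉c with uniform ch y y∉c
    ...   | inj₁ y⟶c = inj₁ λ j<m → y⟶c (+-monoʳ-< i j<m)
    ...   | inj₂ c⟶y = inj₂ λ j<m → c⟶y (+-monoʳ-< i j<m)

  Span : ∀ {k} → Fin n → (Fin k → Fin n) → Fin n → Pred (Fin n) 0ℓ
  Span u w v y = y ≡ u ⊎ y ≡ v ⊎ ∃ λ l → y ≡ w l

  module Enumeration {k u v} {w : Fin k → Fin n} {c : ℕ → Fin n}
    (c₀≡u : c 0 ≡ u) (cₖ≡v : c (suc k) ≡ v) (cₗ≡w : ∀ l → c (suc (toℕ l)) ≡ w l) where

    Span⇒InChain : ∀ {y} → Span u w v y → InChain (suc (suc k)) c y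
    Span⇒InChain (inj₁ refl)              = 0 , z<s , sym c₀≡u
    Span⇒InChain (inj₂ (inj₁ refl))       = suc k , n<1+n _ , sym cₖ≡v
    Span⇒InChain (inj₂ (inj₂ (l , refl))) =
      suc (toℕ l) , s<s (m<n⇒m<1+n (toℕ<n l)) , sym (cₗ≡w l)

    InChain⇒Span : ∀ {y} → InChain (suc (suc k)) c y → Span u w v y
    InChain⇒Span (i , i<2+k , refl) with <2+-view i<2+k
    ... | inj₁ refl              = inj₁ c₀≡u
    ... | inj₂ (inj₁ refl)       = inj₂ (inj₁ cₖ≡v)
    ... | inj₂ (inj₂ (l , refl)) = inj₂ (inj₂ (l , cₗ≡w l))

  Chain-ends⇒↷ : ∀ {k c} → Chain (suc (suc k)) c → c 0 ↷ c (suc k)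
  Chain-ends⇒↷ {k} {c} ch = ascending ch z<s (n<1+n _) , k , w , inner , ordered , outside
    where
    w : Fin k → Fin n
    w l = c (suc (toℕ l))
    open Enumeration {k} {w = w} {c} refl refl (λ _ → refl)
    C = Span (c 0) w (c (suc k))
    inner : ∀ l → c 0 ⟶ w l × w l ⟶ c (suc k)
    inner l = ascending ch z<s (s<s (m<n⇒m<1+n (toℕ<n l))) , ascending ch (s<s (toℕ<n l)) (n<1+n _)
    ordered : ∀ l l′ → l Fin.< l′ → w l ⟶ w l′
    ordered l l′ l<l′ = ascending ch (s<s l<l′) (s<s (m<n⇒m<1+n (toℕ<n l′)))
    outside : ∀ y → ¬ C y → (∀ z → C z → y ⟶ z) ⊎ (∀ z → C z → z ⟶ y)
    outside y y∉ with uniform ch y (y∉ ∘ InChain⇒Span)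
    ... | inj₁ y⟶c = inj₁ λ z z∈C → case Span⇒InChain z∈C of λ { (i , i< , refl) → y⟶c i< }
    ... | inj₂ c⟶y = inj₂ λ z z∈C → case Span⇒InChain z∈C of λ { (i , i< , refl) → c⟶y i< }

  bracket : ∀ {k} → Fin n → (Fin k → Fin n) → Fin n → ℕ → Fin n
  bracket u w v zero = u
  bracket {k} u w v (suc i) with i ℕ.<? k
  ... | yes i<k = w (fromℕ< i<k)
  ... | no  _   = v

  bracket-last : ∀ {k} u (w : Fin k → Fin n) v → bracket u w v (suc k) ≡ v
  bracket-last {k} u w v with k ℕ.<? k
  ... | yes k<k = contradiction k<k (<-irrefl refl)
  ... | no  _   = refl

  bracket-inner : ∀ {k} u (w : Fin k → Fin n) v l → bracket u w v (suc (toℕ l)) ≡ w l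
  bracket-inner {k} u w v l with toℕ l ℕ.<? k
  ... | yes l<k = cong w (fromℕ<-toℕ l l<k)
  ... | no  l≮k = contradiction (toℕ<n l) l≮k

  ↷⇒Chain : ∀ {u v} → u ↷ v →
            ∃ λ k → ∃ λ c → Chain (suc (suc k)) c × c 0 ≡ u × c (suc k) ≡ v
  ↷⇒Chain {u} {v} (u⟶v , k , w , inner , ordered , outside) =
    k , c , record { ascending = ascending′ ; uniform = uniform′ } , refl , last
    where
    c = bracket u w v
    last = bracket-last u w v
    at = bracket-inner u w v
    open Enumeration {k} {u} {v} {w} {c} refl last at
    ascending′ : ∀ {i j} → i < j → j < suc (suc k) → c i ⟶ c j
    ascending′ {i} {j} i<j j<2+k with <2+-view (<-trans i<j j<2+k) | <2+-view j<2+k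
    ... | inj₁ refl              | inj₂ (inj₁ refl)        = subst (u ⟶_) (sym last) u⟶v
    ... | inj₁ refl              | inj₂ (inj₂ (l , refl))  =
      subst (u ⟶_) (sym (at l)) (proj₁ (inner l))
    ... | inj₂ (inj₂ (l , refl)) | inj₂ (inj₁ refl)        =
      subst₂ _⟶_ (sym (at l)) (sym last) (proj₂ (inner l))
    ... | inj₂ (inj₂ (l , refl)) | inj₂ (inj₂ (l′ , refl)) =
      subst₂ _⟶_ (sym (at l)) (sym (at l′)) (ordered l l′ (s<s⁻¹ i<j))
    ... | _                      | inj₁ refl               = contradiction i<j λ ()
    ... | inj₂ (inj₁ refl)       | inj₂ (inj₁ refl)        = contradiction i<j (<-irrefl refl)
    ... | inj₂ (inj₁ refl)       | inj₂ (inj₂ (l , refl))  =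
      contradiction (<-trans (s<s⁻¹ i<j) (toℕ<n l)) (<-irrefl refl)
    uniform′ : ∀ y → ¬ InChain (suc (suc k)) c y → Uniform (suc (suc k)) c y
    uniform′ y y∉ with outside y (y∉ ∘ Span⇒InChain)
    ... | inj₁ y⟶C = inj₁ λ i<2+k → y⟶C _ (InChain⇒Span (_ , i<2+k , refl))
    ... | inj₂ C⟶y = inj₂ λ i<2+k → C⟶y _ (InChain⇒Span (_ , i<2+k , refl))

  Chain⇒↷ : ∀ {m c i j} → Chain m c → i < j → j < m → c i ↷ c j
  Chain⇒↷ {m} {c} {i} ch i<j j<m with d , refl ← m≤n⇒∃[o]m+o≡n i<j =
    subst₂ _↷_ (cong c (+-identityʳ i)) (cong c (+-suc i d))
      (Chain-ends⇒↷ (Chain-drop i (Chain-take ch i+2+d≤m)))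
    where
    i+2+d≤m : i + suc (suc d) ≤ m
    i+2+d≤m = subst (_≤ m) (sym (trans (+-suc i (suc d)) (cong suc (+-suc i d)))) j<m

  Chain⇒∼ : ∀ {m c i j} → Chain m c → i < m → j < m → c i ∼ c j
  Chain⇒∼ {i = i} {j} ch i<m j<m with <-cmp i j
  ... | tri< i<j _ _  = inj₂ (inj₁ (Chain⇒↷ ch i<j j<m))
  ... | tri≈ _ refl _ = inj₁ refl
  ... | tri> _ _ j<i  = inj₂ (inj₂ (Chain⇒↷ ch j<i i<m))

  splice : ℕ → (ℕ → Fin n) → (ℕ → Fin n) → ℕ → Fin n
  splice s c d i with i ℕ.<? s
  ... | yes _ = c i
  ... | no  _ = d (i ∸ s)

  splice-< : ∀ {s} c d {i} → i < s → splice s c d i ≡ c i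
  splice-< {s} c d {i} i<s with i ℕ.<? s
  ... | yes _   = refl
  ... | no  i≮s = contradiction i<s i≮s

  splice-+ : ∀ s c d j → splice s c d (s + j) ≡ d j
  splice-+ s c d j with s + j ℕ.<? s
  ... | yes s+j<s = contradiction s+j<s (m+n≮m s j)
  ... | no  _     = cong d (m+n∸m≡n s j)

  module _ {s m c d} (ch₁ : Chain (suc s) c) (ch₂ : Chain (suc m) d) (cₛ≡d₀ : c s ≡ d 0) where

    private
      cd = splice s c d

      cd-< : ∀ {i} → i < s → cd i ≡ c i
      cd-< = splice-< c d

      cd-+ : ∀ j → cd (s + j) ≡ d j
      cd-+ = splice-+ s c d

      splice-all : ∀ {P : Pred (Fin n) 0ℓ} → (∀ {i} → i < suc s → P (c i)) →
                   (∀ {j} → j < suc m → P (d j)) → ∀ {i} → i < s + suc m → P (cd i)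
      splice-all {P} Pc Pd i<s+1+m with <-+-view {s = s} i<s+1+m
      ... | inj₁ i<s                = subst P (sym (cd-< i<s)) (Pc (m<n⇒m<1+n i<s))
      ... | inj₂ (j , j<1+m , refl) = subst P (sym (cd-+ j)) (Pd j<1+m)

      c⟶d : ∀ {i j} → i < s → j < suc m → c i ⟶ d j
      c⟶d {i} {zero}  i<s _ = subst (c i ⟶_) cₛ≡d₀ (ascending ch₁ i<s (n<1+n s))
      c⟶d {i} {suc j} i<s 1+j<1+m with uniform ch₁ (d (suc j)) d∉c
        where
        d∉c : ¬ InChain (suc s) c (d (suc j))
        d∉c (p , p<1+s , dⱼ≡cₚ) = ≤⇒≯ (s≤s⁻¹ p<1+s) (Chain-index-< ch₁ (n<1+n s) p<1+s
          (subst₂ _⟶_ (sym cₛ≡d₀) dⱼ≡cₚ (ascending ch₂ z<s 1+j<1+m)))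
      ... | inj₁ d⟶c  = contradiction (subst (d (suc j) ⟶_) cₛ≡d₀ (d⟶c (n<1+n s)))
                                      (⟶-asym (ascending ch₂ z<s 1+j<1+m))
      ... | inj₂ c⟶d′ = c⟶d′ (m<n⇒m<1+n i<s)

    Chain-splice : Chain (s + suc m) (splice s c d)
    Chain-splice = record { ascending = ascending′ ; uniform = uniform′ }
      where
      ascending′ : ∀ {i j} → i < j → j < s + suc m → cd i ⟶ cd j
      ascending′ {i} {j} i<j j< with <-+-view {s = s} (<-trans i<j j<) | <-+-view {s = s} j<
      ... | inj₁ i<s | inj₁ j<s =
        subst₂ _⟶_ (sym (cd-< i<s)) (sym (cd-< j<s)) (ascending ch₁ i<j (m<n⇒m<1+n j<s))
      ... | inj₁ i<s | inj₂ (j′ , j′< , refl) =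
        subst₂ _⟶_ (sym (cd-< i<s)) (sym (cd-+ j′)) (c⟶d i<s j′<)
      ... | inj₂ (i′ , _ , refl) | inj₂ (j′ , j′< , refl) =
        subst₂ _⟶_ (sym (cd-+ i′)) (sym (cd-+ j′))
          (ascending ch₂ (+-cancelˡ-< s i′ j′ i<j) j′<)
      ... | inj₂ (i′ , _ , refl) | inj₁ j<s = contradiction (<-trans i<j j<s) (m+n≮m s i′)
      uniform′ : ∀ y → ¬ InChain (s + suc m) cd y → Uniform (s + suc m) cd y
      uniform′ y y∉ with uniform ch₁ y y∉c | uniform ch₂ y y∉d
        where
        y∉c : ¬ InChain (suc s) c y
        y∉c (p , p<1+s , refl) with m<1+n⇒m<n∨m≡n p<1+s
        ... | inj₁ p<s  = y∉ (p , <-≤-trans p<s (m≤m+n s _) , sym (cd-< p<s))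
        ... | inj₂ refl = y∉ (s + 0 , +-monoʳ-< s z<s , trans cₛ≡d₀ (sym (cd-+ 0)))
        y∉d : ¬ InChain (suc m) d y
        y∉d (p , p<1+m , refl) = y∉ (s + p , +-monoʳ-< s p<1+m , sym (cd-+ p))
      ... | inj₁ y⟶c | inj₁ y⟶d = inj₁ (splice-all {y ⟶_} y⟶c y⟶d)
      ... | inj₂ c⟶y | inj₂ d⟶y = inj₂ (splice-all {_⟶ y} c⟶y d⟶y)
      ... | inj₁ y⟶c | inj₂ d⟶y =
        contradiction (subst (y ⟶_) cₛ≡d₀ (y⟶c (n<1+n s))) (⟶-asym (d⟶y z<s))
      ... | inj₂ c⟶y | inj₁ y⟶d =
        contradiction (subst (_⟶ y) cₛ≡d₀ (c⟶y (n<1+n s))) (⟶-asym (y⟶d z<s))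

  ↷-trans : ∀ {u v x} → u ↷ v → v ↷ x → u ↷ x
  ↷-trans u↷v v↷x with ↷⇒Chain u↷v | ↷⇒Chain v↷x
  ... | k₁ , c , ch₁ , refl , cₖ≡v | k₂ , d , ch₂ , refl , dₖ≡x =
    subst₂ _↷_ (splice-< {suc k₁} c d z<s) (trans (splice-+ (suc k₁) c d (suc k₂)) dₖ≡x)
      (Chain⇒↷ (Chain-splice ch₁ ch₂ cₖ≡v) z<s (+-monoʳ-< (suc k₁) (n<1+n (suc k₂))))

  ↷-interval : ∀ {u v y} → u ↷ v → u ⟶ y → y ⟶ v → u ∼ y × y ∼ v
  ↷-interval {y = y} u↷v u⟶y y⟶v with ↷⇒Chain u↷v
  ... | k , c , ch , refl , refl with inChain? _ c y
  ...   | yes (p , p<2+k , refl) = Chain⇒∼ ch z<s p<2+k , Chain⇒∼ ch p<2+k (n<1+n _)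
  ...   | no  y∉ with uniform ch y y∉
  ...     | inj₁ y⟶c = contradiction (y⟶c z<s) (⟶-asym u⟶y)
  ...     | inj₂ c⟶y = contradiction (c⟶y (n<1+n _)) (⟶-asym y⟶v)

  ∼-sym : ∀ {u v} → u ∼ v → v ∼ u
  ∼-sym (inj₁ refl)        = inj₁ refl
  ∼-sym (inj₂ (inj₁ u↷v)) = inj₂ (inj₂ u↷v)
  ∼-sym (inj₂ (inj₂ v↷u)) = inj₂ (inj₁ v↷u)

  ↷-common-target : ∀ {u x v} → u ↷ v → x ↷ v → u ∼ x
  ↷-common-target {u} {x} u↷v x↷v with u ≟ᶠ x
  ... | yes u≡x = inj₁ u≡x
  ... | no  u≢x with ⟶-connex u≢x
  ...   | inj₁ u⟶x = proj₁ (↷-interval u↷v u⟶x (proj₁ x↷v))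
  ...   | inj₂ x⟶u = ∼-sym (proj₁ (↷-interval x↷v x⟶u (proj₁ u↷v)))

  ↷-common-source : ∀ {v u x} → v ↷ u → v ↷ x → u ∼ x
  ↷-common-source {v} {u} {x} v↷u v↷x with u ≟ᶠ x
  ... | yes u≡x = inj₁ u≡x
  ... | no  u≢x with ⟶-connex u≢x
  ...   | inj₁ u⟶x = proj₂ (↷-interval v↷x (proj₁ v↷u) u⟶x)
  ...   | inj₂ x⟶u = ∼-sym (proj₂ (↷-interval v↷u (proj₁ v↷x) x⟶u))

  ∼-trans : ∀ {u v x} → u ∼ v → v ∼ x → u ∼ x
  ∼-trans (inj₁ refl)        v∼x                = v∼x
  ∼-trans u∼v                (inj₁ refl)        = u∼v
  ∼-trans (inj₂ (inj₁ u↷v)) (inj₂ (inj₁ v↷x)) = inj₂ (inj₁ (↷-trans u↷v v↷x))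
  ∼-trans (inj₂ (inj₁ u↷v)) (inj₂ (inj₂ x↷v)) = ↷-common-target u↷v x↷v
  ∼-trans (inj₂ (inj₂ v↷u)) (inj₂ (inj₁ v↷x)) = ↷-common-source v↷u v↷x
  ∼-trans (inj₂ (inj₂ v↷u)) (inj₂ (inj₂ x↷v)) = inj₂ (inj₂ (↷-trans x↷v v↷u))

  ∼-isEquivalence : IsEquivalence _∼_
  ∼-isEquivalence = record { refl = inj₁ refl ; sym = ∼-sym ; trans = ∼-trans }

  ∼∧⟶⇒↷ : ∀ {u v} → u ∼ v → u ⟶ v → u ↷ v
  ∼∧⟶⇒↷ (inj₁ refl)        u⟶u = contradiction u⟶u ⟶-irrefl
  ∼∧⟶⇒↷ (inj₂ (inj₁ u↷v)) _   = u↷v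
  ∼∧⟶⇒↷ (inj₂ (inj₂ v↷u)) u⟶v = contradiction (proj₁ v↷u) (⟶-asym u⟶v)

  ↷-⟶-trans : ∀ {u v x} → u ↷ v → v ⟶ x → u ⟶ x
  ↷-⟶-trans {x = x} u↷v v⟶x with ↷⇒Chain u↷v
  ... | k , c , ch , refl , refl with inChain? _ c x
  ...   | yes (p , p<2+k , refl) =
    contradiction (Chain-index-< ch (n<1+n _) p<2+k v⟶x) (≤⇒≯ (s≤s⁻¹ p<2+k))
  ...   | no  x∉ with uniform ch x x∉
  ...     | inj₁ x⟶c = contradiction (x⟶c (n<1+n _)) (⟶-asym v⟶x)
  ...     | inj₂ c⟶x = c⟶x z<s

  ↷-module : ∀ {u v x} → u ↷ v → ¬ x ∼ u → adj T x u ≡ adj T x v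
  ↷-module {x = x} u↷v x≁u with ↷⇒Chain u↷v
  ... | k , c , ch , refl , refl with inChain? _ c x
  ...   | yes (p , p<2+k , refl) = contradiction (Chain⇒∼ ch p<2+k z<s) x≁u
  ...   | no  x∉ with uniform ch x x∉
  ...     | inj₁ x⟶c = trans (x⟶c z<s) (sym (x⟶c (n<1+n _)))
  ...     | inj₂ c⟶x = trans (¬⟶⇒adj≡false (⟶-asym (c⟶x z<s)))
                              (sym (¬⟶⇒adj≡false (⟶-asym (c⟶x (n<1+n _)))))

  ∼-module : ∀ {u v x} → u ∼ v → ¬ x ∼ u → adj T x u ≡ adj T x v
  ∼-module (inj₁ refl)        _   = refl
  ∼-module (inj₂ (inj₁ u↷v)) x≁u = ↷-module u↷v x≁u
  ∼-module (inj₂ (inj₂ v↷u)) x≁u =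
    sym (↷-module v↷u λ x∼v → x≁u (∼-trans x∼v (inj₂ (inj₁ v↷u))))

  adj-respects-∼ : ∀ {u u′ v v′} → u ∼ u′ → v ∼ v′ → ¬ u ∼ v → adj T u v ≡ adj T u′ v′
  adj-respects-∼ {u} {u′} {v} {v′} u∼u′ v∼v′ u≁v = begin
    adj T u v         ≡⟨ ∼-module v∼v′ u≁v ⟩
    adj T u v′        ≡⟨ adj-flip (λ { refl → u≁v (∼-sym v∼v′) }) ⟩
    not (adj T v′ u)  ≡⟨ cong not (∼-module u∼u′ v′≁u) ⟩
    not (adj T v′ u′) ≡⟨ adj-flip (λ { refl → u≁v (∼-trans u∼u′ (∼-sym v∼v′)) }) ⟨
    adj T u′ v′       ∎
    where
    open ≡-Reasoning
    v′≁u : ¬ v′ ∼ u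
    v′≁u v′∼u = u≁v (∼-sym (∼-trans v∼v′ v′∼u))

  ⟶-into-block : ∀ {u v w} → Dec (w ∼ u) → u ∼ v → u ⟶ v → w ⟶ u → w ⟶ v
  ⟶-into-block (yes w∼u) _   u⟶v w⟶u = ↷-⟶-trans (∼∧⟶⇒↷ w∼u w⟶u) u⟶v
  ⟶-into-block (no  w≁u) u∼v _   w⟶u = trans (sym (∼-module u∼v w≁u)) w⟶u

-- A canonical tournament on positions 0, …, n - 1: position p lies in block number
-- |{j | cut j ≤ p}|, arcs inside a block go from smaller to larger position, and arcs
-- between blocks are given by blockArc.
record Shape (n M : ℕ) : Set where
  field
    cut      : Fin M → Fin (suc n)
    blockArc : Fin (suc M) → Fin (suc M) → Bool

open Shape

blockAt : ∀ {M} → Shape n M → Fin n → Fin (suc M)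
blockAt s p = fromℕ< (s≤s (count≤n (λ j → cut s j ≤? p)))

arcs : ∀ {M} → Shape n M → Fin n → Fin n → Bool
arcs s p q with blockAt s p ≟ᶠ blockAt s q
... | yes _ = does (p <? q)
... | no  _ = blockArc s (blockAt s p) (blockAt s q)

arcs-sameBlock : ∀ {M} (s : Shape n M) {p q} → blockAt s p ≡ blockAt s q →
                 arcs s p q ≡ does (p <? q)
arcs-sameBlock s {p} {q} same with blockAt s p ≟ᶠ blockAt s q
... | yes _     = refl
... | no  other = contradiction same other

arcs-otherBlock : ∀ {M} (s : Shape n M) {p q} → blockAt s p ≢ blockAt s q →
                  arcs s p q ≡ blockArc s (blockAt s p) (blockAt s q)
arcs-otherBlock s {p} {q} other with blockAt s p ≟ᶠ blockAt s q
... | yes same = contradiction same other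
... | no  _    = refl

record Represents {M} (T : Tournament n) (s : Shape n M) : Set where
  field
    relabel  : Fin n ↔ Fin n
    adj≡arcs : ∀ u v → adj T u v ≡ arcs s (Inverse.to relabel u) (Inverse.to relabel v)

infix 4 _≋_

_≋_ : ∀ {M} → Shape n M → Shape n M → Set
s ≋ s′ = (∀ j → cut s j ≡ cut s′ j) × (∀ i j → blockArc s i j ≡ blockArc s′ i j)

blockAt-cong : ∀ {M} {s s′ : Shape n M} → s ≋ s′ → ∀ p → blockAt s p ≡ blockAt s′ p
blockAt-cong {s = s} {s′} (cut≡ , _) p = toℕ-injective (begin
  toℕ (blockAt s p)            ≡⟨ toℕ-fromℕ< _ ⟩
  count (λ j → cut s j ≤? p)   ≡⟨ count-cong (λ j → cut s j ≤? p) (λ j → cut s′ j ≤? p)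
                                    (subst (Fin._≤ p) (cut≡ _)) (subst (Fin._≤ p) (sym (cut≡ _))) ⟩
  count (λ j → cut s′ j ≤? p)  ≡⟨ toℕ-fromℕ< _ ⟨
  toℕ (blockAt s′ p)           ∎)
  where open ≡-Reasoning

arcs-cong : ∀ {M} {s s′ : Shape n M} → s ≋ s′ → ∀ p q → arcs s p q ≡ arcs s′ p q
arcs-cong {s = s} {s′} s≋s′ p q = by-cases (blockAt s p ≟ᶠ blockAt s q)
  where
  open ≡-Reasoning
  p≡ = blockAt-cong s≋s′ p
  q≡ = blockAt-cong s≋s′ q
  by-cases : Dec (blockAt s p ≡ blockAt s q) → arcs s p q ≡ arcs s′ p q
  by-cases (yes same) =
    trans (arcs-sameBlock s same) (sym (arcs-sameBlock s′ (trans (sym p≡) (trans same q≡))))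
  by-cases (no other) = begin
    arcs s p q                                ≡⟨ arcs-otherBlock s other ⟩
    blockArc s (blockAt s p) (blockAt s q)    ≡⟨ proj₂ s≋s′ _ _ ⟩
    blockArc s′ (blockAt s p) (blockAt s q)   ≡⟨ cong₂ (blockArc s′) p≡ q≡ ⟩
    blockArc s′ (blockAt s′ p) (blockAt s′ q) ≡⟨ arcs-otherBlock s′ other′ ⟨
    arcs s′ p q                               ∎
    where other′ = λ same′ → other (trans p≡ (trans same′ (sym q≡)))

Represents⇒Iso : ∀ {M} {T T′ : Tournament n} {s s′ : Shape n M} →
                 Represents T s → Represents T′ s′ → s ≋ s′ → Iso T T′
Represents⇒Iso {T = T} {T′} {s} {s′} T≈s T′≈s′ s≋s′ = ↔-trans π (↔-sym π′) , λ u v → begin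
  adj T′ (from π′ (to π u)) (from π′ (to π v))                   ≡⟨ T′≡s′ _ _ ⟩
  arcs s′ (to π′ (from π′ (to π u))) (to π′ (from π′ (to π v)))  ≡⟨ cong₂ (arcs s′) (cancel u)
                                                                                      (cancel v) ⟩
  arcs s′ (to π u) (to π v)                                       ≡⟨ arcs-cong s≋s′ _ _ ⟨
  arcs s (to π u) (to π v)                                        ≡⟨ T≡s u v ⟨
  adj T u v                                                       ∎
  where
  open ≡-Reasoning
  open Inverse
  open Represents T≈s renaming (relabel to π; adj≡arcs to T≡s)
  open Represents T′≈s′ renaming (relabel to π′; adj≡arcs to T′≡s′)
  cancel = λ u → strictlyInverseˡ π′ (to π u)

shapeCount : ℕ → ℕ → ℕ
shapeCount n M = (2 ^ suc M) ^ suc M * suc n ^ M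

funToFin-injective : ∀ {m n} (f g : Fin m → Fin n) → funToFin f ≡ funToFin g → ∀ i → f i ≡ g i
funToFin-injective f g f≡g i = begin
  f i                      ≡⟨ finToFun-funToFin f i ⟨
  finToFun (funToFin f) i  ≡⟨ cong (λ k → finToFun k i) f≡g ⟩
  finToFun (funToFin g) i  ≡⟨ finToFun-funToFin g i ⟩
  g i                      ∎
  where open ≡-Reasoning

arcRow : ∀ {M} → Shape n M → Fin (suc M) → Fin (suc M) → Fin 2
arcRow s i j = Inverse.from 2↔Bool (blockArc s i j)

shapeCode : ∀ {M} → Shape n M → Fin (shapeCount n M)
shapeCode s = combine (funToFin λ i → funToFin (arcRow s i)) (funToFin (cut s))

shapeCode-injective : ∀ {M} (s s′ : Shape n M) → shapeCode s ≡ shapeCode s′ → s ≋ s′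
shapeCode-injective s s′ code≡ with rows≡ , cut≡ ← combine-injective _ _ _ _ code≡ =
  funToFin-injective (cut s) (cut s′) cut≡ , λ i j → from-injective
    (funToFin-injective (arcRow s i) (arcRow s′ i)
      (funToFin-injective (λ i → funToFin (arcRow s i)) (λ i → funToFin (arcRow s′ i)) rows≡ i) j)
  where
  open Inverse 2↔Bool
  from-injective : ∀ {x y} → from x ≡ from y → x ≡ y
  from-injective {x} {y} e = trans (sym (strictlyInverseˡ x)) (trans (cong to e) (strictlyInverseˡ y))

countAtMost-shapeCount : ∀ {P : Property} M →
  (∀ (T : Tournament n) → P T → ¬ ¬ Σ (Shape n M) (Represents T)) → CountAtMost P n (shapeCount n M)
countAtMost-shapeCount {n = n} M representable ts Pts distinct =
  decidable-stable (length ts ℕ.≤? shapeCount n M) λ ≰ →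
    ¬¬-Π (λ i → representable (lookup ts i) (All.lookup Pts (∈-lookup i))) λ reps →
      contradiction (injective⇒≤ (code-injective reps)) ≰
  where
  Representations = ∀ i → Σ (Shape n M) (Represents (lookup ts i))

  code : Representations → Fin (length ts) → Fin (shapeCount n M)
  code reps i = shapeCode (proj₁ (reps i))

  code≡⇒Iso : (reps : Representations) → ∀ i j → code reps i ≡ code reps j →
              Iso (lookup ts i) (lookup ts j)
  code≡⇒Iso reps i j e = Represents⇒Iso (proj₂ (reps i)) (proj₂ (reps j)) (shapeCode-injective _ _ e)

  code-injective : (reps : Representations) → Injective _≡_ _≡_ (code reps)
  code-injective reps {i} {j} code≡ with Fin.<-cmp i j
  ... | tri< i<j _ _ = contradiction (code≡⇒Iso reps i j code≡) (AllPairs-lookup distinct i<j)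
  ... | tri≈ _ i≡j _ = i≡j
  ... | tri> _ _ j<i = contradiction (code≡⇒Iso reps j i (sym code≡)) (AllPairs-lookup distinct j<i)

module Canonical (M : ℕ) (T : Tournament n) (_∼?_ : Decidable (T ⊢_∼_))
                 (Q : Quotient (T ⊢_∼_)) (size≤ : Quotient.size Q ≤ suc M) where

  open HomogeneousBlocks T
  open Quotient Q

  block : Fin n → Fin (suc M)
  block u = inject≤ (class u) size≤

  block≡⇒∼ : ∀ {u v} → block u ≡ block v → u ∼ v
  block≡⇒∼ = ≡⇒R ∘ inject≤-injective size≤ size≤ _ _

  ∼⇒block≡ : ∀ {u v} → u ∼ v → block u ≡ block v
  ∼⇒block≡ = cong (λ c → inject≤ c size≤) ∘ R⇒≡

  indegree : Fin n → ℕ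
  indegree u = count (λ w → adj T w u Bool.≟ true)

  indegree-mono : ∀ {u v} → u ∼ v → u ⟶ v → indegree u < indegree v
  indegree-mono {u} u∼v u⟶v =
    count-strict _ _ (λ {w} → ⟶-into-block (w ∼? u) u∼v u⟶v) u ⟶-irrefl u⟶v

  module Lex = StrictTotalOrder (×-strictTotalOrder <-strictTotalOrder <-strictTotalOrder)

  key : Fin n → ℕ × ℕ
  key u = toℕ (block u) , indegree u

  _≺_ : Rel (Fin n) 0ℓ
  u ≺ v = key u Lex.< key v

  _≺?_ : Decidable _≺_
  u ≺? v = key u Lex.<? key v

  ≺-irrefl : ∀ {u} → ¬ u ≺ u
  ≺-irrefl = Lex.irrefl (refl , refl)

  ≺⇒block≤ : ∀ {u v} → u ≺ v → block u Fin.≤ block v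
  ≺⇒block≤ (inj₁ bu<bv)       = <⇒≤ bu<bv
  ≺⇒block≤ (inj₂ (bu≡bv , _)) = ≤-reflexive bu≡bv

  ∼∧⟶⇒≺ : ∀ {u v} → u ∼ v → u ⟶ v → u ≺ v
  ∼∧⟶⇒≺ u∼v u⟶v = inj₂ (cong toℕ (∼⇒block≡ u∼v) , indegree-mono u∼v u⟶v)

  ≺-connex : ∀ {u v} → u ≢ v → u ≺ v ⊎ v ≺ u
  ≺-connex {u} {v} u≢v with <-cmp (toℕ (block u)) (toℕ (block v))
  ... | tri< bu<bv _ _ = inj₁ (inj₁ bu<bv)
  ... | tri> _ _ bv<bu = inj₂ (inj₁ bv<bu)
  ... | tri≈ _ bu≡bv _ with u∼v ← block≡⇒∼ (toℕ-injective bu≡bv) with ⟶-connex u≢v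
  ...   | inj₁ u⟶v = inj₁ (∼∧⟶⇒≺ u∼v u⟶v)
  ...   | inj₂ v⟶u = inj₂ (∼∧⟶⇒≺ (∼-sym u∼v) v⟶u)

  open Rank _≺?_ ≺-irrefl Lex.trans ≺-connex

  arcBetween? : ∀ i j → Dec (∃ λ u → ∃ λ v → (block u ≡ i × block v ≡ j) × u ⟶ v)
  arcBetween? i j =
    any? λ u → any? λ v → (block u ≟ᶠ i ×-dec block v ≟ᶠ j) ×-dec adj T u v Bool.≟ true

  shape : Shape n M
  shape = record
    { cut      = λ j → fromℕ< (s≤s (count≤n (λ w → block w ≤? j)))
    ; blockArc = λ i j → does (arcBetween? i j)
    }

  toℕ-cut : ∀ j → toℕ (cut shape j) ≡ count (λ w → block w ≤? j)
  toℕ-cut j = toℕ-fromℕ< _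

  cut≤rank : ∀ {u j} → j Fin.< block u → cut shape j Fin.≤ rank u
  cut≤rank {u} {j} j<bu = subst₂ _≤_ (sym (toℕ-cut j)) (sym (toℕ-rank u))
    (count-mono (λ w → block w ≤? j) (_≺? u) (λ bw≤j → inj₁ (≤-<-trans bw≤j j<bu)))

  rank<cut : ∀ {u j} → block u Fin.≤ j → rank u Fin.< cut shape j
  rank<cut {u} {j} bu≤j = subst₂ _<_ (sym (toℕ-rank u)) (sym (toℕ-cut j))
    (count-strict (_≺? u) (λ w → block w ≤? j) (λ w≺u → ℕ.≤-trans (≺⇒block≤ w≺u) bu≤j)
                  u ≺-irrefl bu≤j)

  blockAt-rank : ∀ u → blockAt shape (rank u) ≡ block u
  blockAt-rank u = toℕ-injective (begin
    toℕ (blockAt shape (rank u))           ≡⟨ toℕ-fromℕ< _ ⟩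
    count (λ j → cut shape j ≤? rank u)    ≡⟨ count-cong (λ j → cut shape j ≤? rank u)
                                                         (λ j → j <? block u) cut≤rank⇒< cut≤rank ⟩
    count (λ (j : Fin M) → j <? block u)   ≡⟨ count-< (block u) ⟩
    toℕ (block u)                          ∎)
    where
    open ≡-Reasoning
    cut≤rank⇒< : ∀ {j} → cut shape j Fin.≤ rank u → j Fin.< block u
    cut≤rank⇒< cⱼ≤r = ℕ.≰⇒> λ bu≤j → ℕ.<⇒≱ (rank<cut bu≤j) cⱼ≤r

  blockArc-block : ∀ {u v} → ¬ u ∼ v → blockArc shape (block u) (block v) ≡ adj T u v
  blockArc-block {u} {v} u≁v with adj T u v Bool.≟ true
  ... | yes u⟶v = trans (dec-true (arcBetween? _ _) (u , v , (refl , refl) , u⟶v)) (sym u⟶v)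
  ... | no  u↛v = trans (dec-false (arcBetween? _ _) no-arc) (sym (¬⟶⇒adj≡false u↛v))
    where
    no-arc : ¬ ∃ λ u′ → ∃ λ v′ → (block u′ ≡ block u × block v′ ≡ block v) × u′ ⟶ v′
    no-arc (u′ , v′ , (bu′≡bu , bv′≡bv) , u′⟶v′) = u↛v (trans
      (adj-respects-∼ (block≡⇒∼ (sym bu′≡bu)) (block≡⇒∼ (sym bv′≡bv)) u≁v) u′⟶v′)

  adj-within-block : ∀ {u v} → u ∼ v → adj T u v ≡ does (rank u <? rank v)
  adj-within-block {u} {v} u∼v with adj T u v Bool.≟ true
  ... | yes u⟶v = trans u⟶v (sym (dec-true (rank u <? rank v) (rank-mono (∼∧⟶⇒≺ u∼v u⟶v))))
  ... | no  u↛v = trans (¬⟶⇒adj≡false u↛v) (sym (dec-false (rank u <? rank v) ru≮rv))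
    where
    ru≮rv : ¬ rank u Fin.< rank v
    ru≮rv with u ≟ᶠ v
    ... | yes refl = Fin.<-irrefl refl
    ... | no  u≢v with ⟶-connex u≢v
    ...   | inj₁ u⟶v = contradiction u⟶v u↛v
    ...   | inj₂ v⟶u = Fin.<-asym (rank-mono (∼∧⟶⇒≺ (∼-sym u∼v) v⟶u))

  adj≡arcs-rank : ∀ u v → adj T u v ≡ arcs shape (rank u) (rank v)
  adj≡arcs-rank u v = by-cases (block u ≟ᶠ block v)
    where
    open ≡-Reasoning
    bu = blockAt-rank u
    bv = blockAt-rank v
    by-cases : Dec (block u ≡ block v) → adj T u v ≡ arcs shape (rank u) (rank v)
    by-cases (yes same) = begin
      adj T u v                     ≡⟨ adj-within-block (block≡⇒∼ same) ⟩
      does (rank u <? rank v)       ≡⟨ arcs-sameBlock shape (trans bu (trans same (sym bv))) ⟨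
      arcs shape (rank u) (rank v)  ∎
    by-cases (no other) = begin
      adj T u v                                     ≡⟨ blockArc-block (other ∘ ∼⇒block≡) ⟨
      blockArc shape (block u) (block v)            ≡⟨ cong₂ (blockArc shape) bu bv ⟨
      blockArc shape (blockAt shape (rank u)) (blockAt shape (rank v))
                                                    ≡⟨ arcs-otherBlock shape other′ ⟨
      arcs shape (rank u) (rank v)                  ∎
      where other′ = λ same′ → other (trans (sym bu) (trans same′ bv))

  represents : Represents T shape
  represents = record { relabel = rank↔ ; adj≡arcs = adj≡arcs-rank }

Quotient⇒HasBlocks : {T : Tournament n} (Q : Quotient (T ⊢_∼_)) → HasBlocks T (Quotient.size Q)
Quotient⇒HasBlocks Q = class , surjective , λ u v → R⇒≡ , ≡⇒R
  where
  open Quotient Q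
  surjective : Surjective _≡_ _≡_ class
  surjective c with u , refl ← class-surjective c = u , λ { refl → refl }

-- ↷ quantifies over witnesses, so ∼ is not evidently decidable; but as the goal is
-- eventually a decidable inequality, decidability of ∼ may be assumed under ¬ ¬.
boundedBlocks⇒¬¬Represents : ∀ M (T : Tournament n) → (∀ c → HasBlocks T c → c ≤ suc M) →
                             ¬ ¬ Σ (Shape n M) (Represents T)
boundedBlocks⇒¬¬Represents {n} M T bounded = ¬¬-map canonical ¬¬-decidable
  where
  canonical : Decidable (T ⊢_∼_) → Σ (Shape n M) (Represents T)
  canonical _∼?_ = shape , represents
    where
    Q : Quotient (T ⊢_∼_)
    Q = quotient _∼?_ (HomogeneousBlocks.∼-isEquivalence T)
    open Canonical M T _∼?_ Q (bounded _ (Quotient⇒HasBlocks {T = T} Q))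

shapeCount≤ : ∀ M → 1 ≤ n → shapeCount n M ≤ (2 ^ suc M) ^ suc M * 2 ^ M * n ^ M
shapeCount≤ {n} M 1≤n = begin
  arcCodes * suc n ^ M        ≤⟨ ℕ.*-monoʳ-≤ arcCodes (ℕ.^-monoˡ-≤ M 1+n≤2*n) ⟩
  arcCodes * (2 * n) ^ M      ≡⟨ cong (arcCodes *_) (^-distribʳ-* 2 n M) ⟩
  arcCodes * (2 ^ M * n ^ M)  ≡⟨ ℕ.*-assoc arcCodes (2 ^ M) (n ^ M) ⟨
  arcCodes * 2 ^ M * n ^ M    ∎
  where
  open ℕ.≤-Reasoning
  arcCodes = (2 ^ suc M) ^ suc M
  1+n≤2*n : suc n ≤ 2 * n
  1+n≤2*n = ℕ.+-mono-≤ 1≤n (≤-reflexive (sym (+-identityʳ n)))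

-- Only the bound B(𝒫) ≤ M + 1 is used: neither heredity nor the attainment of M + 1.
lemma4 : (P : Property) → Hereditary P → (M : ℕ) → SupBlocks≡ P (suc M) → CountBigO P M
lemma4 P _ M (bounded , _) = (2 ^ suc M) ^ suc M * 2 ^ M , 1 , λ n 1≤n ts Pts distinct →
  ℕ.≤-trans (countAtMost-shapeCount {P = P} M representable ts Pts distinct) (shapeCount≤ M 1≤n)
  where
  representable : ∀ {n} (T : Tournament n) → P T → ¬ ¬ Σ (Shape n M) (Represents T)
  representable T PT = boundedBlocks⇒¬¬Represents M T (bounded T PT)
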